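{- Let $\omega=\frac{ -1+\sqrt{ -3}}{2}$ and define the Lehmer-Euler numbers $W_n$ by $$\sum_{n=0}^\infty W_n\frac{t^n}{n!}=\frac{3}{e^{t}+e^{\omega t}+e^{\omega^2 t}}=\left(\sum_{l=0}^\infty\frac{t^{3l}}{(3l)!}\right)^{ -1}$$ (the numbers $W_{3n}$ are integers). Denote by $r_k(n)\in\{0,1,\dots,3^k-1\}$ the least non-negative residue of $W_{3n}$ modulo $3^k$. Then $r_k(0)=1$ for all $k$, and: (1) For $n\ge 1$, the sequence $(r_2(n))_{n\ge1}$ is periodic with period $2$, with $(r_2(1),r_2(2))=(8,1)$. (2) For $n\ge 1$, the sequence $(r_3(n))_{n\ge1}$ is periodic with period $6$, with $(r_3(1),\dots,r_3(6))=(26,19,26,1,8,1)$. (3) For $n\ge 1$, the sequence $(r_4(n))_{n\ge1}$ is periodic with period $2\cdot 3^2=18$, with $(r_4(1),\dots,r_4(18))=(80, 19, 26, 28, 62, 28, 26, 19, 80, 1, 62, 55, 53, 19, 53, 55, 62, 1)$. (4) For $n\ge 1$, the sequence $(r_5(n))_{n\ge1}$ is periodic with period $2\cdot 3^3=54$, with $(r_5(1),\dots,r_5(54))$ equal to $(242, 19, 188, 109, 62, 28, 107, 19, 80, 82, 224, 217, 53, 181, 53, 217, 224, 82, 80, 19, 107, 28, 62, 109, 188, 19, 242, 1, 224, 55, 134, 181, 215, 136, 224, 163, 161, 19, 26, 190, 62, 190, 26, 19, 161, 163, 224, 136, 215, 181, 134, 55, 224, 1)$. -}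

module Defs where

open import Data.Nat as ℕ using (ℕ; zero; suc; _≟_)
open import Data.Nat.Properties using (m^n≢0)
open import Data.Nat.Combinatorics using (_C_)
open import Data.Nat.DivMod using (_%_)
open import Data.Integer using (ℤ; +_; -_; _+_; _*_; 0ℤ; 1ℤ)
open import Data.Integer.DivMod using (_%ℕ_)
open import Data.List using (List; []; _∷_)
open import Relation.Nullary using (yes; no)

-- Coefficients (times k!) of the power series  Σ_l t^{3l}/(3l)!  = (e^t + e^{ωt} + e^{ω²t})/3 :
-- a k = 1 if 3 ∣ k, and 0 otherwise.
a : ℕ → ℤ
a k with k % 3 ≟ 0
... | yes _ = 1ℤ
... | no  _ = 0ℤ

-- The Lehmer–Euler numbers W_n are the coefficients of the exponential generating
-- function (Σ_k a_k t^k/k!)^{-1}, i.e. the unique sequence with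
--   Σ_{k=0}^{n} C(n,k) a_k W_{n-k} = [n = 0]   for all n
-- (the coefficient of t^n/n! in the product of the two EGFs).  Since a_0 = 1 this gives
--   W_0 = 1,  W_n = - Σ_{k=1}^{n} C(n,k) a_k W_{n-k}   (n ≥ 1).  For ws = [W_{n-1}, …, W_0],
-- sumAux n j ws = Σ_{i} C(n, j+i+1) a_{j+i+1} ws[i].
sumAux : ℕ → ℕ → List ℤ → ℤ
sumAux n j []       = 0ℤ
sumAux n j (w ∷ ws) = (+ (n C suc j)) * a (suc j) * w + sumAux n (suc j) ws

next : ℕ → List ℤ → ℤ
next zero    ws = 1ℤ
next (suc m) ws = - sumAux (suc m) 0 ws

revW : ℕ → List ℤ
revW zero    = []
revW (suc n) = next n (revW n) ∷ revW n

W : ℕ → ℤ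
W n = next n (revW n)

r : ℕ → ℕ → ℕ
r k n = (W (3 ℕ.* n) %ℕ (3 ℕ.^ k)) {{m^n≢0 3 k}}

{-# OPTIONS --safe #-}
module Submission where

open import Defs
open import Data.Nat using (ℕ; suc; _+_)
open import Data.List using (List; []; _∷_; map; upTo)
open import Data.Product using (_×_)
open import Relation.Binary.PropositionalEquality using (_≡_)

-- W is the inverse of a (a_k = 1 if 3 ∣ k, else 0) for the binomial convolution
-- conv n f g = Σ_k C(n,k) f_k g_{n-k}, the product of exponential generating functions.
-- Hence any u with u₀ = 1 and conv (n+1) a u ≡ 0 (mod 3⁵) for all n agrees with W modulo 3⁵;
-- we take for u the 162-periodic sequence built from the claimed residues.  By Leibniz' rule
-- conv (n+1) f g = conv n f (g ∘ suc) + conv n (f ∘ suc) g and periodicity of a and u, the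
-- residues modulo 3⁵ of conv n (a shifted by i) (u shifted by j) form a 3 × 162 table evolving
-- under an explicit map.  A finite computation shows that its (0,0) entry vanishes for
-- n = 1, …, 11 and that the table is stationary from n = 11 on.  The residues modulo 3ᵏ,
-- k ≤ 5, and their periods are then read off from u by computation.

open import Data.Nat using (zero; _*_; _^_; _<_; _⊔_; z<s; s<s; _≟_; NonZero)
open import Data.Product using (_,_)
open import Relation.Binary.PropositionalEquality
  using (_≗_; refl; sym; trans; cong; cong₂; subst; module ≡-Reasoning)
import Data.Nat.Properties as ℕ
import Data.Nat.Divisibility as ℕ
open import Data.Nat.DivMod using (_%_; _mod_; m<n⇒m%n≡m; m%n<n; m%n%n≡m%n; %-distribˡ-+)
open import Data.Nat.Combinatorics using (_C_; nCk+nC[k+1]≡[n+1]C[k+1])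
open import Data.Nat.Combinatorics.Specification using (k>n⇒nCk≡0)
open import Data.Nat.GeneralisedArithmetic using (fold; iterate; iterate-is-fold)
open import Data.Nat.Induction using (<-rec)
open import Data.Integer using (ℤ; +_; -_; _-_; ∣_∣; _⊖_; 0ℤ; 1ℤ) renaming (_+_ to _+ℤ_; _*_ to _*ℤ_)
open import Data.Integer.DivMod using (_%ℕ_; _/ℕ_; n%ℕd<d; a≡a%ℕn+[a/ℕn]*n)
import Data.Integer.Properties as ℤ
open import Data.Integer.Divisibility.Signed
  using (_∣_; divides; ∣-trans; ∣m⇒∣-m; ∣m∣n⇒∣m+n; ∣n⇒∣m*n; ∣⇒∣ᵤ; ∣ᵤ⇒∣)
open import Data.Integer.Tactic.RingSolver using (solve-∀)
open import Data.Fin using (Fin; toℕ)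
import Data.Fin.Properties as Fin
open import Data.Vec using (Vec; []; _∷_; lookup; tabulate)
import Data.Vec.Properties as Vec
import Data.List.Properties as List
open import Function using (_∘_; _$_)
open import Level using (0ℓ)
open import Relation.Binary.Core using (_⇒_)
open import Relation.Binary.Definitions using (Reflexive; Symmetric; Transitive)
open import Relation.Binary.Structures using (IsEquivalence)
open import Relation.Binary.Bundles using (Setoid)
import Relation.Binary.Reasoning.Setoid as SetoidReasoning
open import Relation.Nullary using (Dec; yes; no; contradiction)
open import Relation.Nullary.Decidable using (True; toWitness; _×-dec_)

module Congruence (M : ℕ) where

  infix 4 _≈_
  record _≈_ (x y : ℤ) : Set where
    constructor ∣⇒≈
    field ≈⇒∣ : + M ∣ x - y
  open _≈_ public

  ≈-reflexive : _≡_ ⇒ _≈_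
  ≈-reflexive {x} refl = ∣⇒≈ (divides 0ℤ (ℤ.+-inverseʳ x))

  ≈-refl : Reflexive _≈_
  ≈-refl = ≈-reflexive refl

  ≈-sym : Symmetric _≈_
  ≈-sym {x} {y} (∣⇒≈ M∣x-y) = ∣⇒≈ (subst (+ M ∣_) (negate x y) (∣m⇒∣-m M∣x-y))
    where
    negate : ∀ x y → - (x - y) ≡ y - x
    negate = solve-∀

  ≈-trans : Transitive _≈_
  ≈-trans {x} {y} {z} (∣⇒≈ M∣x-y) (∣⇒≈ M∣y-z) =
    ∣⇒≈ (subst (+ M ∣_) (ℤ.+-minus-telescope x y z) (∣m∣n⇒∣m+n M∣x-y M∣y-z))

  ≈-isEquivalence : IsEquivalence _≈_
  ≈-isEquivalence = record { refl = ≈-refl ; sym = ≈-sym ; trans = ≈-trans }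

  ≈-setoid : Setoid 0ℓ 0ℓ
  ≈-setoid = record { isEquivalence = ≈-isEquivalence }

  +-cong : ∀ {x x′ y y′} → x ≈ x′ → y ≈ y′ → x +ℤ y ≈ x′ +ℤ y′
  +-cong {x} {x′} {y} {y′} (∣⇒≈ M∣x-x′) (∣⇒≈ M∣y-y′) =
    ∣⇒≈ (subst (+ M ∣_) (regroup x x′ y y′) (∣m∣n⇒∣m+n M∣x-x′ M∣y-y′))
    where
    regroup : ∀ x x′ y y′ → (x - x′) +ℤ (y - y′) ≡ (x +ℤ y) - (x′ +ℤ y′)
    regroup = solve-∀

  -‿cong : ∀ {x x′} → x ≈ x′ → - x ≈ - x′
  -‿cong {x} {x′} (∣⇒≈ M∣x-x′) = ∣⇒≈ (subst (+ M ∣_) (regroup x x′) (∣m⇒∣-m M∣x-x′))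
    where
    regroup : ∀ x x′ → - (x - x′) ≡ - x - - x′
    regroup = solve-∀

  *-congˡ : ∀ k {y y′} → y ≈ y′ → k *ℤ y ≈ k *ℤ y′
  *-congˡ k {y} {y′} (∣⇒≈ M∣y-y′) = ∣⇒≈ (subst (+ M ∣_) (regroup k y y′) (∣n⇒∣m*n k M∣y-y′))
    where
    regroup : ∀ k y y′ → k *ℤ (y - y′) ≡ k *ℤ y - k *ℤ y′
    regroup = solve-∀

  +≈0⇒≈- : ∀ {x y} → x +ℤ y ≈ 0ℤ → x ≈ - y
  +≈0⇒≈- {x} {y} (∣⇒≈ M∣x+y) = ∣⇒≈ (subst (+ M ∣_) (regroup x y) M∣x+y)
    where
    regroup : ∀ x y → (x +ℤ y) - 0ℤ ≡ x - - y
    regroup = solve-∀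

  module _ .{{_ : NonZero M}} where

    i≈i%ℕM : ∀ i → i ≈ + (i %ℕ M)
    i≈i%ℕM i = ∣⇒≈ $ divides (i /ℕ M) $ begin
      i - + (i %ℕ M)                                 ≡⟨ cong (_- + (i %ℕ M)) (a≡a%ℕn+[a/ℕn]*n i M) ⟩
      (+ (i %ℕ M) +ℤ i /ℕ M *ℤ + M) - + (i %ℕ M)     ≡⟨ cancel (+ (i %ℕ M)) (i /ℕ M) (+ M) ⟩
      i /ℕ M *ℤ + M                                  ∎
      where
      open ≡-Reasoning
      cancel : ∀ r q m → (r +ℤ q *ℤ m) - r ≡ q *ℤ m
      cancel = solve-∀

    residue-unique : ∀ {u v} → u < M → v < M → + u ≈ + v → u ≡ v
    residue-unique {u} {v} u<M v<M u≈v =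
      ℤ.+-injective (ℤ.i-j≡0⇒i≡j (+ u) (+ v) (ℤ.∣i∣≡0⇒i≡0 ∣u-v∣≡0))
      where
      ∣u-v∣<M : ∣ + u - + v ∣ < M
      ∣u-v∣<M = begin-strict
        ∣ + u - + v ∣ ≡⟨ cong ∣_∣ (ℤ.[+m]-[+n]≡m⊖n u v) ⟩
        ∣ u ⊖ v ∣     ≤⟨ ℤ.∣m⊝n∣≤m⊔n u v ⟩
        u ⊔ v         <⟨ ℕ.⊔-lub u<M v<M ⟩
        M             ∎
        where open ℕ.≤-Reasoning
      ∣u-v∣≡0 : ∣ + u - + v ∣ ≡ 0
      ∣u-v∣≡0 = trans (sym (m<n⇒m%n≡m ∣u-v∣<M)) (ℕ.n∣m⇒m%n≡0 _ M (∣⇒∣ᵤ (≈⇒∣ u≈v)))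

    ≈⇒%ℕ≡ : ∀ {x y} → x ≈ y → x %ℕ M ≡ y %ℕ M
    ≈⇒%ℕ≡ {x} {y} x≈y = residue-unique (n%ℕd<d x M) (n%ℕd<d y M)
      (≈-trans (≈-sym (i≈i%ℕM x)) (≈-trans x≈y (i≈i%ℕM y)))

≈-divisor : ∀ {d M x y} → d ℕ.∣ M → Congruence._≈_ M x y → Congruence._≈_ d x y
≈-divisor d∣M (Congruence.∣⇒≈ M∣x-y) = Congruence.∣⇒≈ (∣-trans (∣ᵤ⇒∣ d∣M) M∣x-y)

convFrom : ℕ → ℕ → ℕ → (ℕ → ℤ) → (ℕ → ℤ) → ℤ
convFrom n j zero    f g = + (n C j) *ℤ f j *ℤ g 0
convFrom n j (suc m) f g = + (n C j) *ℤ f j *ℤ g (suc m) +ℤ convFrom n (suc j) m f g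

conv : ℕ → (ℕ → ℤ) → (ℕ → ℤ) → ℤ
conv n = convFrom n 0 n

convFrom-cong : ∀ n j m {f f′ g g′} → f ≗ f′ → g ≗ g′ → convFrom n j m f g ≡ convFrom n j m f′ g′
convFrom-cong n j zero    f≗f′ g≗g′ = cong₂ (λ x y → + (n C j) *ℤ x *ℤ y) (f≗f′ j) (g≗g′ 0)
convFrom-cong n j (suc m) f≗f′ g≗g′ =
  cong₂ _+ℤ_ (cong₂ (λ x y → + (n C j) *ℤ x *ℤ y) (f≗f′ j) (g≗g′ (suc m))) (convFrom-cong n (suc j) m f≗f′ g≗g′)

pascal-ℤ : ∀ n k → + (suc n C suc k) ≡ + (n C k) +ℤ + (n C suc k)
pascal-ℤ n k = trans (cong +_ (sym (nCk+nC[k+1]≡[n+1]C[k+1] n k))) (ℤ.pos-+ (n C k) (n C suc k))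

convFrom-pascal : ∀ n j m f g →
  convFrom (suc n) (suc j) m f g ≡ convFrom n (suc j) m f g +ℤ convFrom n j m (f ∘ suc) g
convFrom-pascal n j zero f g =
  trans (cong (λ c → c *ℤ f (suc j) *ℤ g 0) (pascal-ℤ n j)) (distrib (+ (n C j)) (+ (n C suc j)) (f (suc j)) (g 0))
  where
  distrib : ∀ c c′ x y → (c +ℤ c′) *ℤ x *ℤ y ≡ c′ *ℤ x *ℤ y +ℤ c *ℤ x *ℤ y
  distrib = solve-∀
convFrom-pascal n j (suc m) f g = begin
  term (+ (suc n C suc j)) +ℤ convFrom (suc n) (suc (suc j)) m f g
    ≡⟨ cong₂ _+ℤ_ (cong term (pascal-ℤ n j)) (convFrom-pascal n (suc j) m f g) ⟩
  term (+ (n C j) +ℤ + (n C suc j)) +ℤ (rest +ℤ rest′)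
    ≡⟨ regroup (+ (n C j)) (+ (n C suc j)) (f (suc j)) (g (suc m)) rest rest′ ⟩
  (term (+ (n C suc j)) +ℤ rest) +ℤ (term (+ (n C j)) +ℤ rest′)
    ∎
  where
  open ≡-Reasoning
  term : ℤ → ℤ
  term c = c *ℤ f (suc j) *ℤ g (suc m)
  rest rest′ : ℤ
  rest  = convFrom n (suc (suc j)) m f g
  rest′ = convFrom n (suc j) m (f ∘ suc) g
  regroup : ∀ c c′ x y s s′ → (c +ℤ c′) *ℤ x *ℤ y +ℤ (s +ℤ s′) ≡ (c′ *ℤ x *ℤ y +ℤ s) +ℤ (c *ℤ x *ℤ y +ℤ s′)
  regroup = solve-∀

convFrom-last : ∀ n j m f g →
  convFrom n j (suc m) f g ≡ convFrom n j m f (g ∘ suc) +ℤ + (n C (j + suc m)) *ℤ f (j + suc m) *ℤ g 0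
convFrom-last n j zero f g =
  cong (λ k → + (n C j) *ℤ f j *ℤ g 1 +ℤ + (n C k) *ℤ f k *ℤ g 0) (ℕ.+-comm 1 j)
convFrom-last n j (suc m) f g = begin
  x +ℤ convFrom n (suc j) (suc m) f g             ≡⟨ cong (x +ℤ_) (convFrom-last n (suc j) m f g) ⟩
  x +ℤ (rest +ℤ last (suc j + suc m))              ≡⟨ ℤ.+-assoc x rest (last (suc j + suc m)) ⟨
  x +ℤ rest +ℤ last (suc j + suc m)                ≡⟨ cong (λ k → x +ℤ rest +ℤ last k) (ℕ.+-suc j (suc m)) ⟨
  x +ℤ rest +ℤ last (j + suc (suc m))              ∎
  where
  open ≡-Reasoning
  x rest : ℤ
  x    = + (n C j) *ℤ f j *ℤ g (suc (suc m))
  rest = convFrom n (suc j) m f (g ∘ suc)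
  last : ℕ → ℤ
  last k = + (n C k) *ℤ f k *ℤ g 0

conv-suc : ∀ n f g → conv (suc n) f g ≡ conv n f (g ∘ suc) +ℤ conv n (f ∘ suc) g
conv-suc n f g = begin
  x +ℤ convFrom (suc n) 1 n f g                          ≡⟨ cong (x +ℤ_) (convFrom-pascal n 0 n f g) ⟩
  x +ℤ (convFrom n 1 n f g +ℤ conv n (f ∘ suc) g)         ≡⟨ ℤ.+-assoc x (convFrom n 1 n f g) (conv n (f ∘ suc) g) ⟨
  convFrom n 0 (suc n) f g +ℤ conv n (f ∘ suc) g          ≡⟨ cong (_+ℤ conv n (f ∘ suc) g) (convFrom-last n 0 n f g) ⟩
  conv n f (g ∘ suc) +ℤ + (n C suc n) *ℤ f (suc n) *ℤ g 0 +ℤ conv n (f ∘ suc) g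
    ≡⟨ cong (λ c → conv n f (g ∘ suc) +ℤ + c *ℤ f (suc n) *ℤ g 0 +ℤ conv n (f ∘ suc) g) (k>n⇒nCk≡0 (ℕ.n<1+n n)) ⟩
  conv n f (g ∘ suc) +ℤ 0ℤ +ℤ conv n (f ∘ suc) g           ≡⟨ cong (_+ℤ conv n (f ∘ suc) g) (ℤ.+-identityʳ (conv n f (g ∘ suc))) ⟩
  conv n f (g ∘ suc) +ℤ conv n (f ∘ suc) g                 ∎
  where
  open ≡-Reasoning
  x = + 1 *ℤ f 0 *ℤ g (suc n)

sumAux≡convFrom : ∀ n j m → sumAux n j (revW (suc m)) ≡ convFrom n (suc j) m a W
sumAux≡convFrom n j zero    = ℤ.+-identityʳ _
sumAux≡convFrom n j (suc m) = cong (+ (n C suc j) *ℤ a (suc j) *ℤ W (suc m) +ℤ_) (sumAux≡convFrom n (suc j) m)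

W-suc : ∀ m → W (suc m) ≡ - convFrom (suc m) 1 m a W
W-suc m = cong -_ (sumAux≡convFrom (suc m) 0 m)

conv-a-suc : ∀ m u → conv (suc m) a u ≡ u (suc m) +ℤ convFrom (suc m) 1 m a u
conv-a-suc m u = cong (_+ℤ convFrom (suc m) 1 m a u) (ℤ.*-identityˡ (u (suc m)))

module _ (M : ℕ) where
  open Congruence M

  convFrom-congʳ : ∀ n j m f {g g′} → (∀ {k} → k < suc m → g k ≈ g′ k) →
                   convFrom n j m f g ≈ convFrom n j m f g′
  convFrom-congʳ n j zero    f g≈g′ = *-congˡ (+ (n C j) *ℤ f j) (g≈g′ z<s)
  convFrom-congʳ n j (suc m) f g≈g′ =
    +-cong (*-congˡ (+ (n C j) *ℤ f j) (g≈g′ (ℕ.n<1+n (suc m))))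
           (convFrom-congʳ n (suc j) m f (g≈g′ ∘ ℕ.m<n⇒m<1+n))

  W-unique : ∀ u → u 0 ≡ 1ℤ → (∀ n → conv (suc n) a u ≈ 0ℤ) → ∀ n → W n ≈ u n
  W-unique u u₀≡1 conv≈0 = <-rec _ W≈u
    where
    open SetoidReasoning ≈-setoid
    W≈u : ∀ n → (∀ {k} → k < n → W k ≈ u k) → W n ≈ u n
    W≈u zero    _   = ≈-reflexive (sym u₀≡1)
    W≈u (suc m) W≈u<suc-m = begin
      W (suc m)                    ≡⟨ W-suc m ⟩
      - convFrom (suc m) 1 m a W   ≈⟨ -‿cong (convFrom-congʳ (suc m) 1 m a W≈u<suc-m) ⟩
      - convFrom (suc m) 1 m a u   ≈⟨ ≈-sym (+≈0⇒≈- (subst (_≈ 0ℤ) (conv-a-suc m u) (conv≈0 m))) ⟩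
      u (suc m)                    ∎

module _ {N : ℕ} .{{_ : NonZero N}} where

  toℕ-mod : ∀ m → toℕ (m mod N) ≡ m % N
  toℕ-mod m = Fin.toℕ-fromℕ< (m%n<n m N)

  +-mod : ∀ s m → (s + toℕ (m mod N)) mod N ≡ (s + m) mod N
  +-mod s m = Fin.toℕ-injective $ begin
    toℕ ((s + toℕ (m mod N)) mod N) ≡⟨ toℕ-mod (s + toℕ (m mod N)) ⟩
    (s + toℕ (m mod N)) % N         ≡⟨ cong (λ x → (s + x) % N) (toℕ-mod m) ⟩
    (s + m % N) % N                 ≡⟨ %-distribˡ-+ s (m % N) N ⟩
    (s % N + m % N % N) % N         ≡⟨ cong (λ x → (s % N + x) % N) (m%n%n≡m%n m N) ⟩
    (s % N + m % N) % N             ≡⟨ %-distribˡ-+ s m N ⟨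
    (s + m) % N                     ≡⟨ toℕ-mod (s + m) ⟨
    toℕ ((s + m) mod N)             ∎
    where open ≡-Reasoning

  sucMod : Fin N → Fin N
  sucMod i = suc (toℕ i) mod N

iterate-fixed : ∀ {A : Set} {f : A → A} {x} → f x ≡ x → ∀ n → iterate f x n ≡ x
iterate-fixed fx≡x zero    = refl
iterate-fixed fx≡x (suc n) rewrite fx≡x = iterate-fixed fx≡x n

module Tables (M : ℕ) .{{_ : NonZero M}} (p q : ℕ) .{{_ : NonZero p}} .{{_ : NonZero q}} where
  open Congruence M
  open SetoidReasoning ≈-setoid

  Table : Set
  Table = Vec (Vec ℕ q) p

  entry : Table → ℕ → ℕ → ℕ
  entry t i j = lookup (lookup t (i mod p)) (j mod q)

  corner : Table → ℕ
  corner t = entry t 0 0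

  entry-tabulate : ∀ (h : Fin p → Fin q → ℕ) i j →
                   entry (tabulate λ I → tabulate (h I)) i j ≡ h (i mod p) (j mod q)
  entry-tabulate h i j = trans (cong (λ row → lookup row (j mod q)) (Vec.lookup∘tabulate _ (i mod p)))
                               (Vec.lookup∘tabulate (h (i mod p)) (j mod q))

  initial : (Fin p → ℤ) → (Fin q → ℤ) → Table
  initial F G = tabulate λ I → tabulate λ J → (F I *ℤ G J) %ℕ M

  step : Table → Table
  step t = tabulate λ I → tabulate λ J →
    (lookup (lookup t I) (sucMod J) + lookup (lookup t (sucMod I)) J) % M

  entry-step : ∀ t i j → entry (step t) i j ≡ (entry t i (suc j) + entry t (suc i) j) % M
  entry-step t i j = trans (entry-tabulate _ i j)
    (cong₂ (λ I′ J′ → (lookup (lookup t (i mod p)) J′ + lookup (lookup t I′) (j mod q)) % M)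
           (+-mod 1 i) (+-mod 1 j))

  Represents : ℕ → (ℕ → ℤ) → (ℕ → ℤ) → Table → Set
  Represents n f g t = ∀ i j → conv n (λ x → f (i + x)) (λ x → g (j + x)) ≈ + entry t i j

  represents-initial : ∀ {f g} F G → f ≗ F ∘ (_mod p) → g ≗ G ∘ (_mod q) →
                       Represents 0 f g (initial F G)
  represents-initial {f} {g} F G f≗F g≗G i j = begin
    + 1 *ℤ f (i + 0) *ℤ g (j + 0)         ≡⟨ cong₂ (λ x y → + 1 *ℤ x *ℤ y) (cong f (ℕ.+-identityʳ i))
                                                                          (cong g (ℕ.+-identityʳ j)) ⟩
    + 1 *ℤ f i *ℤ g j                     ≡⟨ cong (_*ℤ g j) (ℤ.*-identityˡ (f i)) ⟩
    f i *ℤ g j                            ≡⟨ cong₂ _*ℤ_ (f≗F i) (g≗G j) ⟩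
    F (i mod p) *ℤ G (j mod q)            ≈⟨ i≈i%ℕM (F (i mod p) *ℤ G (j mod q)) ⟩
    + ((F (i mod p) *ℤ G (j mod q)) %ℕ M) ≡⟨ cong +_ (entry-tabulate _ i j) ⟨
    + entry (initial F G) i j             ∎

  represents-step : ∀ {n f g t} → Represents n f g t → Represents (suc n) f g (step t)
  represents-step {n} {f} {g} {t} rep i j = begin
    conv (suc n) fᵢ gⱼ
      ≡⟨ conv-suc n fᵢ gⱼ ⟩
    conv n fᵢ (gⱼ ∘ suc) +ℤ conv n (fᵢ ∘ suc) gⱼ
      ≡⟨ cong₂ _+ℤ_ (convFrom-cong n 0 n (λ _ → refl) (cong g ∘ ℕ.+-suc j))
                    (convFrom-cong n 0 n (cong f ∘ ℕ.+-suc i) (λ _ → refl)) ⟩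
    conv n fᵢ (λ x → g (suc j + x)) +ℤ conv n (λ x → f (suc i + x)) gⱼ
      ≈⟨ +-cong (rep i (suc j)) (rep (suc i) j) ⟩
    + entry t i (suc j) +ℤ + entry t (suc i) j
      ≡⟨ ℤ.pos-+ (entry t i (suc j)) (entry t (suc i) j) ⟨
    + (entry t i (suc j) + entry t (suc i) j)
      ≈⟨ i≈i%ℕM (+ (entry t i (suc j) + entry t (suc i) j)) ⟩
    + ((entry t i (suc j) + entry t (suc i) j) % M)
      ≡⟨ cong +_ (entry-step t i j) ⟨
    + entry (step t) i j
      ∎
    where
    fᵢ gⱼ : ℕ → ℤ
    fᵢ x = f (i + x)
    gⱼ x = g (j + x)

  represents-fold : ∀ {f g} F G → f ≗ F ∘ (_mod p) → g ≗ G ∘ (_mod q) →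
                    ∀ n → Represents n f g (fold (initial F G) step n)
  represents-fold F G f≗F g≗G zero    = represents-initial F G f≗F g≗G
  represents-fold {f} {g} F G f≗F g≗G (suc n) =
    represents-step {n} {f} {g} {fold (initial F G) step n} (represents-fold F G f≗F g≗G n)

  Settles : ℕ → Table → Set
  Settles zero    t = corner t ≡ 0 × step t ≡ t
  Settles (suc k) t = corner t ≡ 0 × Settles k (step t)

  settles? : ∀ k t → Dec (Settles k t)
  settles? zero    t = corner t ≟ 0 ×-dec Vec.≡-dec (Vec.≡-dec _≟_) (step t) t
  settles? (suc k) t = corner t ≟ 0 ×-dec settles? k (step t)

  settles⇒corner≡0 : ∀ k t → Settles k t → ∀ n → corner (iterate step t n) ≡ 0
  settles⇒corner≡0 zero    t (corner≡0 , fixed) n       = trans (cong corner (iterate-fixed fixed n)) corner≡0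
  settles⇒corner≡0 (suc k) t (corner≡0 , _)     zero    = corner≡0
  settles⇒corner≡0 (suc k) t (_ , settles)      (suc n) = settles⇒corner≡0 k (step t) settles n

-- The residues of W₃ₙ modulo 3⁵ for n = 0, …, 53 claimed by the theorem; W_n = 0 unless 3 ∣ n.
W₃ₙ-residues : Vec ℕ 54
W₃ₙ-residues = 1 ∷ 242 ∷ 19 ∷ 188 ∷ 109 ∷ 62 ∷ 28 ∷ 107 ∷ 19 ∷ 80 ∷ 82 ∷ 224 ∷ 217 ∷ 53 ∷ 181 ∷ 53 ∷ 217 ∷ 224 ∷ 82 ∷ 80 ∷ 19 ∷ 107 ∷ 28 ∷ 62 ∷ 109 ∷ 188 ∷ 19 ∷ 242 ∷ 1 ∷ 224 ∷ 55 ∷ 134 ∷ 181 ∷ 215 ∷ 136 ∷ 224 ∷ 163 ∷ 161 ∷ 19 ∷ 26 ∷ 190 ∷ 62 ∷ 190 ∷ 26 ∷ 19 ∷ 161 ∷ 163 ∷ 224 ∷ 136 ∷ 215 ∷ 181 ∷ 134 ∷ 55 ∷ 224 ∷ []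

spread : ∀ {n} → Vec ℕ n → Vec ℕ (n * 3)
spread []       = []
spread (x ∷ xs) = x ∷ 0 ∷ 0 ∷ spread xs

W-residues : Fin 162 → ℕ
W-residues = lookup (spread W₃ₙ-residues)

periodicW : ℕ → ℤ
periodicW n = + W-residues (n mod 162)

a[i]≡a[i%3] : ∀ i → a i ≡ a (i % 3)
a[i]≡a[i%3] i with i % 3 ≟ 0 | i % 3 % 3 ≟ 0 | m%n%n≡m%n i 3
... | yes _       | yes _         | _ = refl
... | no  _       | no  _         | _ = refl
... | yes i%3≡0   | no  i%3%3≢0   | e = contradiction (trans e i%3≡0) i%3%3≢0
... | no  i%3≢0   | yes i%3%3≡0   | e = contradiction (trans (sym e) i%3%3≡0) i%3≢0

module _ where
  open Congruence 243
  open Tables 243 3 162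
  open SetoidReasoning ≈-setoid

  table₀ : Table
  table₀ = initial (a ∘ toℕ) (+_ ∘ W-residues)

  -- The whole check is one evaluation of settles?, so the iterated tables are shared.  A separate
  -- definition of type Settles 10 (step table₀) makes type checking recompute them without sharing.
  corner≡0 : ∀ n → corner (iterate step (step table₀) n) ≡ 0
  corner≡0 = settles⇒corner≡0 10 (step table₀) (toWitness {a? = settles? 10 (step table₀)} _)

  conv-periodicW≈0 : ∀ n → conv (suc n) a periodicW ≈ 0ℤ
  conv-periodicW≈0 n = begin
    conv (suc n) a periodicW
      ≈⟨ represents-fold (a ∘ toℕ) (+_ ∘ W-residues) a≗ (λ _ → refl) (suc n) 0 0 ⟩
    + corner (fold table₀ step (suc n))
      ≡⟨ cong (+_ ∘ corner) (iterate-is-fold table₀ step (suc n)) ⟩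
    + corner (iterate step (step table₀) n)
      ≡⟨ cong +_ (corner≡0 n) ⟩
    0ℤ
      ∎
    where
    a≗ : a ≗ a ∘ toℕ ∘ (_mod 3)
    a≗ i = trans (a[i]≡a[i%3] i) (cong a (sym (toℕ-mod i)))

  W≈periodicW : ∀ n → W n ≈ periodicW n
  W≈periodicW = W-unique 243 periodicW refl conv-periodicW≈0

residue : ℕ → Fin 162 → ℕ
residue k x = (W-residues x % 3 ^ k) {{ℕ.m^n≢0 3 k}}

r≡residue : ∀ k → 3 ^ k ℕ.∣ 3 ^ 5 → ∀ n → r k n ≡ residue k ((3 * n) mod 162)
r≡residue k 3^k∣3⁵ n = Congruence.≈⇒%ℕ≡ (3 ^ k) {{ℕ.m^n≢0 3 k}} (≈-divisor 3^k∣3⁵ (W≈periodicW (3 * n)))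

ShiftInvariant : ℕ → ℕ → Set
ShiftInvariant k s = ∀ x → residue k ((s + toℕ x) mod 162) ≡ residue k x

shiftInvariant? : ∀ k s → Dec (ShiftInvariant k s)
shiftInvariant? k s = Fin.all? λ x → residue k ((s + toℕ x) mod 162) ≟ residue k x

r-periodic : ∀ k p → 3 ^ k ℕ.∣ 3 ^ 5 → True (shiftInvariant? k (3 * p)) → ∀ n → r k (n + p) ≡ r k n
r-periodic k p 3^k∣3⁵ invariant n = begin
  r k (n + p)                                         ≡⟨ r≡residue k 3^k∣3⁵ (n + p) ⟩
  residue k ((3 * (n + p)) mod 162)                   ≡⟨ cong (λ m → residue k (m mod 162)) 3[n+p]≡3p+3n ⟩
  residue k ((3 * p + 3 * n) mod 162)                 ≡⟨ cong (residue k) (+-mod (3 * p) (3 * n)) ⟨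
  residue k ((3 * p + toℕ ((3 * n) mod 162)) mod 162) ≡⟨ toWitness invariant ((3 * n) mod 162) ⟩
  residue k ((3 * n) mod 162)                         ≡⟨ r≡residue k 3^k∣3⁵ n ⟨
  r k n                                               ∎
  where
  open ≡-Reasoning
  3[n+p]≡3p+3n : 3 * (n + p) ≡ 3 * p + 3 * n
  3[n+p]≡3p+3n = trans (ℕ.*-distribˡ-+ 3 n p) (ℕ.+-comm (3 * n) (3 * p))

r-values : ∀ k → 3 ^ k ℕ.∣ 3 ^ 5 → ∀ N →
           map (λ i → r k (suc i)) (upTo N) ≡ map (λ i → residue k ((3 * suc i) mod 162)) (upTo N)
r-values k 3^k∣3⁵ N = List.map-cong (λ i → r≡residue k 3^k∣3⁵ (suc i)) (upTo N)

r-zero : ∀ k → r (suc k) 0 ≡ 1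
r-zero k = m<n⇒m%n≡m {{ℕ.m^n≢0 3 (suc k)}} (ℕ.^-monoʳ-< 3 (s<s z<s) (z<s {k}))

proposition2 : ((k : ℕ) → r (suc k) 0 ≡ 1)
  × (((n : ℕ) → r 2 (suc n + 2) ≡ r 2 (suc n))
     × map (λ i → r 2 (suc i)) (upTo 2) ≡ (8 ∷ 1 ∷ []))
  × (((n : ℕ) → r 3 (suc n + 6) ≡ r 3 (suc n))
     × map (λ i → r 3 (suc i)) (upTo 6) ≡ (26 ∷ 19 ∷ 26 ∷ 1 ∷ 8 ∷ 1 ∷ []))
  × (((n : ℕ) → r 4 (suc n + 18) ≡ r 4 (suc n))
     × map (λ i → r 4 (suc i)) (upTo 18) ≡ (80 ∷ 19 ∷ 26 ∷ 28 ∷ 62 ∷ 28 ∷ 26 ∷ 19 ∷ 80 ∷ 1 ∷ 62 ∷ 55 ∷ 53 ∷ 19 ∷ 53 ∷ 55 ∷ 62 ∷ 1 ∷ []))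
  × (((n : ℕ) → r 5 (suc n + 54) ≡ r 5 (suc n))
     × map (λ i → r 5 (suc i)) (upTo 54) ≡ (242 ∷ 19 ∷ 188 ∷ 109 ∷ 62 ∷ 28 ∷ 107 ∷ 19 ∷ 80 ∷ 82 ∷ 224 ∷ 217 ∷ 53 ∷ 181 ∷ 53 ∷ 217 ∷ 224 ∷ 82 ∷ 80 ∷ 19 ∷ 107 ∷ 28 ∷ 62 ∷ 109 ∷ 188 ∷ 19 ∷ 242 ∷ 1 ∷ 224 ∷ 55 ∷ 134 ∷ 181 ∷ 215 ∷ 136 ∷ 224 ∷ 163 ∷ 161 ∷ 19 ∷ 26 ∷ 190 ∷ 62 ∷ 190 ∷ 26 ∷ 19 ∷ 161 ∷ 163 ∷ 224 ∷ 136 ∷ 215 ∷ 181 ∷ 134 ∷ 55 ∷ 224 ∷ 1 ∷ []))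
proposition2 =
    r-zero
  , ((λ n → r-periodic 2 2  3²∣3⁵ _ (suc n)) , r-values 2 3²∣3⁵ 2)
  , ((λ n → r-periodic 3 6  3³∣3⁵ _ (suc n)) , r-values 3 3³∣3⁵ 6)
  , ((λ n → r-periodic 4 18 3⁴∣3⁵ _ (suc n)) , r-values 4 3⁴∣3⁵ 18)
  , ((λ n → r-periodic 5 54 3⁵∣3⁵ _ (suc n)) , r-values 5 3⁵∣3⁵ 54)
  where
  3²∣3⁵ : 3 ^ 2 ℕ.∣ 3 ^ 5
  3²∣3⁵ = ℕ.divides 27 refl
  3³∣3⁵ : 3 ^ 3 ℕ.∣ 3 ^ 5
  3³∣3⁵ = ℕ.divides 9 refl
  3⁴∣3⁵ : 3 ^ 4 ℕ.∣ 3 ^ 5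
  3⁴∣3⁵ = ℕ.divides 3 refl
  3⁵∣3⁵ : 3 ^ 5 ℕ.∣ 3 ^ 5
  3⁵∣3⁵ = ℕ.∣-refl
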